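{- Let $M=\begin{pmatrix}0&1&0\\1&-1&1\\0&1&0\end{pmatrix}$. For all natural numbers $n$, $|\mathsf{ASM}_n(M)|=n!$. Furthermore, $|\mathsf{ASM}_n(A)|\ge n!$ for every ASM $A$ containing at least one entry equal to $-1$.
   Context: An alternating sign matrix (ASM) is a square matrix with entries in $\{0,1,-1\}$ such that every row and every column sums to $1$ and the nonzero entries of each row and each column alternate in sign. For an ASM $B$ of size $m\times m$, an $n\times n$ ASM $A$ contains $B$ if there are order-preserving injections $f,g:[m]\to[n]$ with $A_{f(i),g(j)}=1$ whenever $B_{i,j}=1$ (i.e. entries $-1$ of $B$ are treated as $0$ and only the $1$'s of $B$ must be matched by $1$'s of $A$); otherwise $A$ avoids $B$. $\mathsf{ASM}_n(B)$ is the set of $n\times n$ ASMs avoiding $B$ in this sense. -}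

module Defs where

open import Data.Nat using (ℕ; zero; suc)
open import Data.Fin using (Fin; _<_)
open import Data.Integer using (ℤ; +_; -[1+_]; -_; _+_; 0ℤ; 1ℤ)
open import Data.List using (List; []; _∷_; map; length; foldr)
open import Data.List.Relation.Unary.Unique.Propositional using (Unique)
open import Data.List.Membership.Propositional using (_∈_)
open import Data.Vec using (Vec; lookup; toList; tabulate)
open import Data.Product using (Σ; _×_; ∃-syntax)
open import Relation.Binary.PropositionalEquality using (_≡_)
open import Relation.Nullary using (¬_)
open import Data.Sum using (_⊎_)
open import Function.Bundles using (_⇔_)

Mat : ℕ → Set
Mat n = Vec (Vec ℤ n) n

entry : ∀ {n} → Mat n → Fin n → Fin n → ℤ
entry A i j = lookup (lookup A i) j

row : ∀ {n} → Mat n → Fin n → List ℤ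
row A i = toList (lookup A i)

col : ∀ {n} → Mat n → Fin n → List ℤ
col A j = toList (tabulate (λ i → entry A i j))

nonzeros : List ℤ → List ℤ
nonzeros [] = []
nonzeros (+ zero ∷ xs) = nonzeros xs
nonzeros (x ∷ xs) = x ∷ nonzeros xs

-- consecutive elements alternate in sign (for entries in {1,-1}: y = - x)
data Alternating : List ℤ → Set where
  alt-[] : Alternating []
  alt-[x] : ∀ x → Alternating (x ∷ [])
  alt-∷ : ∀ x y xs → y ≡ - x → Alternating (y ∷ xs) → Alternating (x ∷ y ∷ xs)

sumℤ : List ℤ → ℤ
sumℤ = foldr _+_ 0ℤ

GoodLine : List ℤ → Set
GoodLine xs = sumℤ xs ≡ 1ℤ × Alternating (nonzeros xs)

record IsASM {n : ℕ} (A : Mat n) : Set where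
  field
    entries : ∀ i j → entry A i j ≡ 0ℤ ⊎ entry A i j ≡ 1ℤ ⊎ entry A i j ≡ -[1+ 0 ]
    rows    : ∀ i → GoodLine (row A i)
    cols    : ∀ j → GoodLine (col A j)

StrictlyIncreasing : ∀ {m n} → (Fin m → Fin n) → Set
StrictlyIncreasing f = ∀ i j → i < j → f i < f j

Contains : ∀ {n m} → Mat n → Mat m → Set
Contains {n} {m} A B =
  ∃[ f ] ∃[ g ] (StrictlyIncreasing {m} {n} f × StrictlyIncreasing {m} {n} g ×
    (∀ i j → entry B i j ≡ 1ℤ → entry A (f i) (g j) ≡ 1ℤ))

Avoids : ∀ {n m} → Mat n → Mat m → Set
Avoids A B = ¬ Contains A B

InASMAvoiding : ∀ {m} (n : ℕ) → Mat m → Mat n → Set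
InASMAvoiding n B A = IsASM A × Avoids A B

Enumerates : ∀ {n} → (Mat n → Set) → List (Mat n) → Set
Enumerates P L = Unique L × (∀ A → (A ∈ L) ⇔ P A)

HasCard : ∀ {n} → (Mat n → Set) → ℕ → Set
HasCard P k = Σ _ λ L → Enumerates P L × length L ≡ k

HasAtLeast : ∀ {n} → (Mat n → Set) → ℕ → Set
HasAtLeast {n} P k = Σ (List (Mat n)) λ L → Unique L × (∀ A → A ∈ L → P A) × (k Data.Nat.≤ length L)

M : Mat 3
M = (0ℤ Data.Vec.∷ 1ℤ Data.Vec.∷ 0ℤ Data.Vec.∷ Data.Vec.[])
  Data.Vec.∷ (1ℤ Data.Vec.∷ -[1+ 0 ] Data.Vec.∷ 1ℤ Data.Vec.∷ Data.Vec.[])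
  Data.Vec.∷ (0ℤ Data.Vec.∷ 1ℤ Data.Vec.∷ 0ℤ Data.Vec.∷ Data.Vec.[])
  Data.Vec.∷ Data.Vec.[]

-- A permutation matrix has a single 1 in each row, so it avoids every pattern with two 1s in
-- one row. Every ASM with an entry -1 is such a pattern: the partial sums along a line of an ASM
-- stay in {0, 1}, so a -1 has a 1 on either side of it, both in its row and in its column. Hence
-- the n! permutation matrices all avoid such an ASM. The four 1s around a -1 of an ASM form an
-- occurrence of M, so an ASM avoiding M has entries in {0, 1} and is a permutation matrix.
module Submission where

open import Defs
open import Data.Nat as ℕ using (ℕ; zero; suc; _!; _*_; z≤n; s≤s)
open import Data.Nat.Properties using (1+n≰n; ≤-reflexive)
open import Data.Fin using (Fin; zero; suc; punchIn; punchOut; _<_)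
open import Data.Fin.Properties
  using (suc-injective; punchIn-injective; punchInᵢ≢i; punchOut-injective; punchIn-punchOut; injective⇒≤; any?; _≟_; <-trans; <-irrefl)
open import Data.Integer as ℤ using (ℤ; 0ℤ; 1ℤ; -1ℤ; -[1+_]; _+_)
open import Data.Integer.Properties using (+-identityˡ; +-identityʳ; +-inverseʳ; +-assoc)
open import Data.Vec as V using (Vec; []; _∷_; lookup; tabulate; toList)
open import Data.Vec.Properties using (∷-injectiveˡ; ∷-injectiveʳ; lookup-map; lookup∘tabulate; tabulate-cong)
open import Data.Vec.Relation.Unary.All using (All; []; _∷_)
open import Data.Vec.Relation.Unary.All.Properties using (lookup⁻; tabulate⁺)
open import Data.Vec.Relation.Binary.Pointwise.Extensional using (ext; Pointwise-≡⇒≡)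
open import Data.List as L using (List; []; _∷_; length; allFin; cartesianProductWith)
open import Data.List.Properties using (length-++; length-map; length-tabulate)
open import Data.List.Membership.Propositional using (_∈_)
open import Data.List.Membership.Propositional.Properties
  using (∈-allFin; ∈-map⁺; ∈-map⁻; ∈-cartesianProductWith⁺; ∈-cartesianProductWith⁻)
open import Data.List.Relation.Unary.Any using (here)
open import Data.List.Relation.Unary.AllPairs using (AllPairs)
import Data.List.Relation.Unary.All as ListAll
open import Data.List.Relation.Unary.Unique.Propositional using (Unique)
import Data.List.Relation.Unary.Unique.Propositional.Properties as Unique
open import Data.Product as Product using (_×_; _,_; proj₁; proj₂; ∃; ∃-syntax; ∃₂)
open import Data.Sum using (_⊎_; inj₁; inj₂; [_,_]′)
open import Data.Empty using (⊥-elim)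
open import Function using (Injective; _∘_; id; case_of_)
open import Function.Bundles using (mk⇔)
open import Relation.Nullary using (¬_; yes; no; contradiction)
open import Relation.Binary.PropositionalEquality hiding ([_])

map-injective : ∀ {A B : Set} {f : A → B} {n} → Injective _≡_ _≡_ f → Injective _≡_ _≡_ (V.map {n = n} f)
map-injective f-inj {[]} {[]} _ = refl
map-injective f-inj {x ∷ xs} {y ∷ ys} e =
  cong₂ _∷_ (f-inj (∷-injectiveˡ e)) (map-injective f-inj (∷-injectiveʳ e))

injective⇒surjective : ∀ {n} {f : Fin n → Fin n} → Injective _≡_ _≡_ f → ∀ j → ∃ λ i → f i ≡ j
injective⇒surjective {suc n} {f} f-inj j with any? (λ i → f i ≟ j)
... | yes hit = hit
... | no miss = contradiction (injective⇒≤ g-inj) 1+n≰n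
  where
  j≢f : ∀ i → j ≢ f i
  j≢f i e = miss (i , sym e)
  g-inj : Injective _≡_ _≡_ (λ i → punchOut (j≢f i))
  g-inj {x} {y} e = f-inj (punchOut-injective (j≢f x) (j≢f y) e)

length-cartesianProductWith : ∀ {A B C : Set} (f : A → B → C) xs ys →
  length (cartesianProductWith f xs ys) ≡ length xs * length ys
length-cartesianProductWith f [] ys = refl
length-cartesianProductWith f (x ∷ xs) ys = trans (length-++ (L.map (f x) ys))
  (cong₂ ℕ._+_ (length-map (f x) ys) (length-cartesianProductWith f xs ys))

IsPermutation : ∀ {n} → Vec (Fin n) n → Set
IsPermutation σ = Injective _≡_ _≡_ (lookup σ)

consPunchIn : ∀ {n} → Fin (suc n) → Vec (Fin n) n → Vec (Fin (suc n)) (suc n)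
consPunchIn k τ = k ∷ V.map (punchIn k) τ

consPunchIn-injective : ∀ {n} {k l : Fin (suc n)} {τ υ} → consPunchIn k τ ≡ consPunchIn l υ → k ≡ l × τ ≡ υ
consPunchIn-injective {k = k} e with refl ← ∷-injectiveˡ e =
  refl , map-injective (punchIn-injective k _ _) (∷-injectiveʳ e)

consPunchIn-isPermutation : ∀ {n} k {τ : Vec (Fin n) n} → IsPermutation τ → IsPermutation (consPunchIn k τ)
consPunchIn-isPermutation k τ-inj {zero} {zero} _ = refl
consPunchIn-isPermutation k {τ} τ-inj {zero} {suc j} e =
  ⊥-elim (punchInᵢ≢i k (lookup τ j) (sym (trans e (lookup-map j (punchIn k) τ))))
consPunchIn-isPermutation k {τ} τ-inj {suc i} {zero} e =
  ⊥-elim (punchInᵢ≢i k (lookup τ i) (trans (sym (lookup-map i (punchIn k) τ)) e))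
consPunchIn-isPermutation k {τ} τ-inj {suc i} {suc j} e = cong suc (τ-inj (punchIn-injective k _ _
  (trans (sym (lookup-map i (punchIn k) τ)) (trans e (lookup-map j (punchIn k) τ)))))

permutations : ∀ n → List (Vec (Fin n) n)
permutations zero = [] ∷ []
permutations (suc n) = cartesianProductWith consPunchIn (allFin (suc n)) (permutations n)

length-permutations : ∀ n → length (permutations n) ≡ n !
length-permutations zero = refl
length-permutations (suc n) =
  trans (length-cartesianProductWith consPunchIn (allFin (suc n)) (permutations n))
        (cong₂ _*_ (length-tabulate {n = suc n} id) (length-permutations n))

permutations-unique : ∀ n → Unique (permutations n)
permutations-unique zero = ListAll.[] AllPairs.∷ AllPairs.[]
permutations-unique (suc n) =
  Unique.cartesianProductWith⁺ consPunchIn consPunchIn-injective (Unique.allFin⁺ (suc n)) (permutations-unique n)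

∈-permutations⁻ : ∀ n {σ} → σ ∈ permutations n → IsPermutation σ
∈-permutations⁻ zero (here refl) {()}
∈-permutations⁻ (suc n) σ∈ with ∈-cartesianProductWith⁻ consPunchIn (allFin (suc n)) (permutations n) σ∈
... | k , τ , _ , τ∈ , refl = consPunchIn-isPermutation k (∈-permutations⁻ n τ∈)

∈-permutations⁺ : ∀ n {σ : Vec (Fin n) n} → IsPermutation σ → σ ∈ permutations n
∈-permutations⁺ zero {[]} _ = here refl
∈-permutations⁺ (suc n) {k ∷ σ} σ-inj =
  subst (_∈ permutations (suc n)) σ≡
    (∈-cartesianProductWith⁺ consPunchIn (∈-allFin k) (∈-permutations⁺ n τ-inj))
  where
  k≢σ : ∀ i → k ≢ lookup σ i
  k≢σ i e with () ← σ-inj {zero} {suc i} e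
  τ : Vec (Fin n) n
  τ = tabulate (λ i → punchOut (k≢σ i))
  τ-inj : IsPermutation τ
  τ-inj {i} {j} e = suc-injective (σ-inj (punchOut-injective (k≢σ i) (k≢σ j)
    (trans (sym (lookup∘tabulate _ i)) (trans e (lookup∘tabulate _ j)))))
  σ≡ : consPunchIn k τ ≡ k ∷ σ
  σ≡ = cong (k ∷_) (Pointwise-≡⇒≡ (ext λ i → trans (lookup-map i (punchIn k) τ)
         (trans (cong (punchIn k) (lookup∘tabulate _ i)) (punchIn-punchOut (k≢σ i)))))

data IsEntry : ℤ → Set where
  is0  : IsEntry 0ℤ
  is1  : IsEntry 1ℤ
  is-1 : IsEntry -1ℤ

sumℤ-alternating : ∀ {x xs} → Alternating (x ∷ xs) → sumℤ (x ∷ xs) ≡ x ⊎ sumℤ (x ∷ xs) ≡ 0ℤ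
sumℤ-alternating (alt-[x] x) = inj₁ (+-identityʳ x)
sumℤ-alternating (alt-∷ x _ _ refl alt) with sumℤ-alternating alt
... | inj₁ s = inj₂ (trans (cong (x +_) s) (+-inverseʳ x))
... | inj₂ s = inj₁ (trans (cong (x +_) s) (+-identityʳ x))

alternating-tail : ∀ {x xs} → Alternating (x ∷ xs) → Alternating xs
alternating-tail (alt-[x] _) = alt-[]
alternating-tail (alt-∷ _ _ _ _ alt) = alt

sumℤ-nonzeros : ∀ xs → sumℤ (nonzeros xs) ≡ sumℤ xs
sumℤ-nonzeros [] = refl
sumℤ-nonzeros (ℤ.+ zero ∷ xs) = trans (sumℤ-nonzeros xs) (sym (+-identityˡ _))
sumℤ-nonzeros (ℤ.+ suc n ∷ xs) = cong (ℤ.+ suc n +_) (sumℤ-nonzeros xs)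
sumℤ-nonzeros (-[1+ n ] ∷ xs) = cong (-[1+ n ] +_) (sumℤ-nonzeros xs)

¬goodLine--1∷ : ∀ xs → ¬ GoodLine (-1ℤ ∷ xs)
¬goodLine--1∷ xs (sum≡1 , alt) with sumℤ-alternating alt
... | inj₁ s = case trans (sym s) (trans (sumℤ-nonzeros (-1ℤ ∷ xs)) sum≡1) of λ ()
... | inj₂ s = case trans (sym s) (trans (sumℤ-nonzeros (-1ℤ ∷ xs)) sum≡1) of λ ()

¬goodLine-1∷1∷ : ∀ xs → ¬ GoodLine (1ℤ ∷ 1ℤ ∷ xs)
¬goodLine-1∷1∷ _ (_ , alt-∷ _ _ _ () _)

goodLine-0∷⁺ : ∀ xs → GoodLine xs → GoodLine (0ℤ ∷ xs)
goodLine-0∷⁺ _ (sum≡1 , alt) = trans (+-identityˡ _) sum≡1 , alt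

goodLine-0∷⁻ : ∀ xs → GoodLine (0ℤ ∷ xs) → GoodLine xs
goodLine-0∷⁻ _ (sum≡1 , alt) = trans (sym (+-identityˡ _)) sum≡1 , alt

goodLine-1∷0∷⁺ : ∀ xs → GoodLine (1ℤ ∷ xs) → GoodLine (1ℤ ∷ 0ℤ ∷ xs)
goodLine-1∷0∷⁺ xs (sum≡1 , alt) = trans (cong (1ℤ +_) (+-identityˡ (sumℤ xs))) sum≡1 , alt

goodLine-1∷0∷⁻ : ∀ xs → GoodLine (1ℤ ∷ 0ℤ ∷ xs) → GoodLine (1ℤ ∷ xs)
goodLine-1∷0∷⁻ xs (sum≡1 , alt) = trans (cong (1ℤ +_) (sym (+-identityˡ (sumℤ xs)))) sum≡1 , alt

goodLine-1∷-1∷⁻ : ∀ xs → GoodLine (1ℤ ∷ -1ℤ ∷ xs) → GoodLine xs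
goodLine-1∷-1∷⁻ xs (sum≡1 , alt) = sum≡1′ , alternating-tail (alternating-tail alt)
  where
  sum≡1′ : sumℤ xs ≡ 1ℤ
  sum≡1′ = begin
    sumℤ xs                  ≡⟨ +-identityˡ _ ⟨
    (1ℤ + -1ℤ) + sumℤ xs     ≡⟨ +-assoc 1ℤ -1ℤ (sumℤ xs) ⟩
    1ℤ + (-1ℤ + sumℤ xs)     ≡⟨ sum≡1 ⟩
    1ℤ                       ∎
    where open ≡-Reasoning

-- The partial sums of a line of an ASM stay in {0, 1}; Line₀ and Line₁ are the suffixes
-- read when the partial sum so far is 0, respectively 1.
mutual
  data Line₀ : ∀ {n} → Vec ℤ n → Set where
    0∷_ : ∀ {n} {v : Vec ℤ n} → Line₀ v → Line₀ (0ℤ ∷ v)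
    1∷_ : ∀ {n} {v : Vec ℤ n} → Line₁ v → Line₀ (1ℤ ∷ v)

  data Line₁ : ∀ {n} → Vec ℤ n → Set where
    []    : Line₁ []
    0∷_  : ∀ {n} {v : Vec ℤ n} → Line₁ v → Line₁ (0ℤ ∷ v)
    -1∷_ : ∀ {n} {v : Vec ℤ n} → Line₀ v → Line₁ (-1ℤ ∷ v)

mutual
  goodLine⇒line₀ : ∀ {n} {v : Vec ℤ n} → All IsEntry v → GoodLine (toList v) → Line₀ v
  goodLine⇒line₀ [] (() , _)
  goodLine⇒line₀ {v = _ ∷ v} (is0 ∷ es) good = 0∷ goodLine⇒line₀ es (goodLine-0∷⁻ (toList v) good)
  goodLine⇒line₀ (is1 ∷ es) good = 1∷ goodLine⇒line₁ es good
  goodLine⇒line₀ {v = _ ∷ v} (is-1 ∷ _) good = ⊥-elim (¬goodLine--1∷ (toList v) good)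

  goodLine⇒line₁ : ∀ {n} {v : Vec ℤ n} → All IsEntry v → GoodLine (1ℤ ∷ toList v) → Line₁ v
  goodLine⇒line₁ [] _ = []
  goodLine⇒line₁ {v = _ ∷ v} (is0 ∷ es) good = 0∷ goodLine⇒line₁ es (goodLine-1∷0∷⁻ (toList v) good)
  goodLine⇒line₁ {v = _ ∷ v} (is1 ∷ _) good = ⊥-elim (¬goodLine-1∷1∷ (toList v) good)
  goodLine⇒line₁ {v = _ ∷ v} (is-1 ∷ es) good = -1∷ goodLine⇒line₀ es (goodLine-1∷-1∷⁻ (toList v) good)

one-in-line₀ : ∀ {n} {v : Vec ℤ n} → Line₀ v → ∃[ r ] lookup v r ≡ 1ℤ
one-in-line₀ (0∷ line) = Product.map suc id (one-in-line₀ line)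
one-in-line₀ (1∷ _) = zero , refl

one-before-minus-one : ∀ {n} {v : Vec ℤ n} → Line₀ v → ∀ p → lookup v p ≡ -1ℤ → ∃[ q ] q < p × lookup v q ≡ 1ℤ
one-before-minus-one (0∷ line) (suc p) e = Product.map suc (Product.map₁ s≤s) (one-before-minus-one line p e)
one-before-minus-one (1∷ _) (suc p) _ = zero , s≤s z≤n , refl

mutual
  one-after-minus-one : ∀ {n} {v : Vec ℤ n} → Line₀ v → ∀ p → lookup v p ≡ -1ℤ → ∃[ r ] p < r × lookup v r ≡ 1ℤ
  one-after-minus-one (0∷ line) (suc p) e = Product.map suc (Product.map₁ s≤s) (one-after-minus-one line p e)
  one-after-minus-one (1∷ line) (suc p) e = Product.map suc (Product.map₁ s≤s) (one-after-minus-one₁ line p e)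

  one-after-minus-one₁ : ∀ {n} {v : Vec ℤ n} → Line₁ v → ∀ p → lookup v p ≡ -1ℤ → ∃[ r ] p < r × lookup v r ≡ 1ℤ
  one-after-minus-one₁ (0∷ line) (suc p) e = Product.map suc (Product.map₁ s≤s) (one-after-minus-one₁ line p e)
  one-after-minus-one₁ (-1∷ line) zero _ = Product.map suc (s≤s z≤n ,_) (one-in-line₀ line)
  one-after-minus-one₁ (-1∷ line) (suc p) e = Product.map suc (Product.map₁ s≤s) (one-after-minus-one line p e)

δ : ∀ {n} → Fin n → Fin n → ℤ
δ zero    zero    = 1ℤ
δ zero    (suc _) = 0ℤ
δ (suc _) zero    = 0ℤ
δ (suc i) (suc j) = δ i j

δ-diag : ∀ {n} (i : Fin n) → δ i i ≡ 1ℤ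
δ-diag zero = refl
δ-diag (suc i) = δ-diag i

δ-sym : ∀ {n} (i j : Fin n) → δ i j ≡ δ j i
δ-sym zero zero = refl
δ-sym zero (suc _) = refl
δ-sym (suc _) zero = refl
δ-sym (suc i) (suc j) = δ-sym i j

δ≡1⇒≡ : ∀ {n} {i j : Fin n} → δ i j ≡ 1ℤ → i ≡ j
δ≡1⇒≡ {i = zero} {zero} _ = refl
δ≡1⇒≡ {i = suc i} {suc j} e = cong suc (δ≡1⇒≡ e)

δ-≢ : ∀ {n} {i j : Fin n} → i ≢ j → δ i j ≡ 0ℤ
δ-≢ {i = zero} {zero} i≢j = contradiction refl i≢j
δ-≢ {i = zero} {suc _} _ = refl
δ-≢ {i = suc _} {zero} _ = refl
δ-≢ {i = suc i} {suc j} i≢j = δ-≢ (i≢j ∘ cong suc)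

δ-bit : ∀ {n} (i j : Fin n) → δ i j ≡ 0ℤ ⊎ δ i j ≡ 1ℤ
δ-bit zero zero = inj₂ refl
δ-bit zero (suc _) = inj₁ refl
δ-bit (suc _) zero = inj₁ refl
δ-bit (suc i) (suc j) = δ-bit i j

δ-injective : ∀ {m n} {f : Fin m → Fin n} → Injective _≡_ _≡_ f → ∀ i j → δ (f i) (f j) ≡ δ i j
δ-injective {f = f} f-inj i j with i ≟ j
... | yes refl = trans (δ-diag (f i)) (sym (δ-diag i))
... | no i≢j = trans (δ-≢ (i≢j ∘ f-inj)) (sym (δ-≢ i≢j))

unitVec : ∀ {n} → Fin n → Vec ℤ n
unitVec k = tabulate (δ k)

zeros : ∀ n → Vec ℤ n
zeros n = tabulate (λ _ → 0ℤ)

goodLine-1∷zeros : ∀ n → GoodLine (1ℤ ∷ toList (zeros n))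
goodLine-1∷zeros zero = refl , alt-[x] 1ℤ
goodLine-1∷zeros (suc n) = goodLine-1∷0∷⁺ (toList (zeros n)) (goodLine-1∷zeros n)

goodLine-unitVec : ∀ {n} (k : Fin n) → GoodLine (toList (unitVec k))
goodLine-unitVec {suc n} zero = goodLine-1∷zeros n
goodLine-unitVec (suc k) = goodLine-0∷⁺ (toList (unitVec k)) (goodLine-unitVec k)

lookup-unitVec-self : ∀ {n} (k : Fin n) → lookup (unitVec k) k ≡ 1ℤ
lookup-unitVec-self k = trans (lookup∘tabulate (δ k) k) (δ-diag k)

unitVec-one : ∀ {n} {k p : Fin n} → lookup (unitVec k) p ≡ 1ℤ → k ≡ p
unitVec-one {k = k} {p} e = δ≡1⇒≡ (trans (sym (lookup∘tabulate (δ k) p)) e)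

unitVec-injective : ∀ {n} → Injective _≡_ _≡_ (unitVec {n})
unitVec-injective {y = l} e = unitVec-one (trans (cong (λ v → lookup v l) e) (lookup-unitVec-self l))

mutual
  line₀-without-minus-one : ∀ {n} {v : Vec ℤ n} → Line₀ v → All (_≢ -1ℤ) v → ∃[ k ] v ≡ unitVec k
  line₀-without-minus-one (0∷ line) (_ ∷ ns) = Product.map suc (cong (0ℤ ∷_)) (line₀-without-minus-one line ns)
  line₀-without-minus-one (1∷ line) (_ ∷ ns) = zero , cong (1ℤ ∷_) (line₁-without-minus-one line ns)

  line₁-without-minus-one : ∀ {n} {v : Vec ℤ n} → Line₁ v → All (_≢ -1ℤ) v → v ≡ zeros n
  line₁-without-minus-one [] [] = refl
  line₁-without-minus-one (0∷ line) (_ ∷ ns) = cong (0ℤ ∷_) (line₁-without-minus-one line ns)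
  line₁-without-minus-one (-1∷ _) (≢-1 ∷ _) = contradiction refl ≢-1

permMatrix : ∀ {n} → Vec (Fin n) n → Mat n
permMatrix = V.map unitVec

IsPermMatrix : ∀ {n} → Mat n → Set
IsPermMatrix A = ∃[ σ ] IsPermutation σ × A ≡ permMatrix σ

entry-permMatrix : ∀ {n} (σ : Vec (Fin n) n) i j → entry (permMatrix σ) i j ≡ δ (lookup σ i) j
entry-permMatrix σ i j = trans (cong (λ r → lookup r j) (lookup-map i unitVec σ)) (lookup∘tabulate _ j)

column : ∀ {n} → Mat n → Fin n → Vec ℤ n
column A j = tabulate (λ i → entry A i j)

column-permMatrix : ∀ {n} {σ : Vec (Fin n) n} → IsPermutation σ → ∀ {i j} → lookup σ i ≡ j →
  column (permMatrix σ) j ≡ unitVec i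
column-permMatrix {σ = σ} σ-inj {i} refl = tabulate-cong λ r → begin
  entry (permMatrix σ) r (lookup σ i)  ≡⟨ entry-permMatrix σ r _ ⟩
  δ (lookup σ r) (lookup σ i)          ≡⟨ δ-injective σ-inj r i ⟩
  δ r i                                ≡⟨ δ-sym r i ⟩
  δ i r                                ∎
  where open ≡-Reasoning

permMatrix-isASM : ∀ {n} {σ : Vec (Fin n) n} → IsPermutation σ → IsASM (permMatrix σ)
permMatrix-isASM {σ = σ} σ-inj = record { entries = entries ; rows = rows ; cols = cols }
  where
  entries : ∀ i j → let x = entry (permMatrix σ) i j in x ≡ 0ℤ ⊎ x ≡ 1ℤ ⊎ x ≡ -1ℤ
  entries i j rewrite entry-permMatrix σ i j = [ inj₁ , inj₂ ∘ inj₁ ]′ (δ-bit (lookup σ i) j)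
  rows : ∀ i → GoodLine (row (permMatrix σ) i)
  rows i = subst (λ v → GoodLine (toList v)) (sym (lookup-map i unitVec σ)) (goodLine-unitVec (lookup σ i))
  cols : ∀ j → GoodLine (col (permMatrix σ) j)
  cols j = let (i , σi≡j) = injective⇒surjective σ-inj j in
    subst (λ v → GoodLine (toList v)) (sym (column-permMatrix {σ = σ} σ-inj σi≡j)) (goodLine-unitVec i)

-- Only the 1s of B have to be matched, and row f r of a permutation matrix has a single 1.
isPermMatrix⇒avoids : ∀ {m n} {A : Mat n} {B : Mat m} {r a b} → IsPermMatrix A →
  entry B r a ≡ 1ℤ → entry B r b ≡ 1ℤ → a < b → Avoids A B
isPermMatrix⇒avoids {B = B} {r} {a} {b} (σ , _ , refl) Bra≡1 Brb≡1 a<b (f , g , _ , g-increasing , match) =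
  <-irrefl (trans (sym (σfr≡g Bra≡1)) (σfr≡g Brb≡1)) (g-increasing a b a<b)
  where
  σfr≡g : ∀ {c} → entry B r c ≡ 1ℤ → lookup σ (f r) ≡ g c
  σfr≡g {c} Brc≡1 = δ≡1⇒≡ (trans (sym (entry-permMatrix σ (f r) (g c))) (match r c Brc≡1))

permMatrices : ∀ n → List (Mat n)
permMatrices n = L.map permMatrix (permutations n)

length-permMatrices : ∀ n → length (permMatrices n) ≡ n !
length-permMatrices n = trans (length-map permMatrix (permutations n)) (length-permutations n)

permMatrices-unique : ∀ n → Unique (permMatrices n)
permMatrices-unique n = Unique.map⁺ (map-injective unitVec-injective) (permutations-unique n)

∈-permMatrices⁺ : ∀ {n} {A : Mat n} → IsPermMatrix A → A ∈ permMatrices n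
∈-permMatrices⁺ {n} (σ , σ-perm , refl) = ∈-map⁺ permMatrix (∈-permutations⁺ n σ-perm)

∈-permMatrices⁻ : ∀ {n} {A : Mat n} → A ∈ permMatrices n → IsPermMatrix A
∈-permMatrices⁻ {n} A∈ with ∈-map⁻ permMatrix A∈
... | σ , σ∈ , A≡ = σ , ∈-permutations⁻ n σ∈ , A≡

isEntry : ∀ {x} → x ≡ 0ℤ ⊎ x ≡ 1ℤ ⊎ x ≡ -1ℤ → IsEntry x
isEntry (inj₁ refl) = is0
isEntry (inj₂ (inj₁ refl)) = is1
isEntry (inj₂ (inj₂ refl)) = is-1

row-line₀ : ∀ {n} {A : Mat n} → IsASM A → ∀ i → Line₀ (lookup A i)
row-line₀ asm i = goodLine⇒line₀ (lookup⁻ (isEntry ∘ IsASM.entries asm i)) (IsASM.rows asm i)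

column-line₀ : ∀ {n} {A : Mat n} → IsASM A → ∀ j → Line₀ (column A j)
column-line₀ asm j = goodLine⇒line₀ (tabulate⁺ (λ i → isEntry (IsASM.entries asm i j))) (IsASM.cols asm j)

minus-one-between-ones : ∀ {n} {v : Vec ℤ n} → Line₀ v → ∀ {p} → lookup v p ≡ -1ℤ →
  ∃₂ λ a b → a < p × p < b × lookup v a ≡ 1ℤ × lookup v b ≡ 1ℤ
minus-one-between-ones line {p} e =
  let (a , a<p , va≡1) = one-before-minus-one line p e
      (b , p<b , vb≡1) = one-after-minus-one line p e
  in a , b , a<p , p<b , va≡1 , vb≡1

minus-one-between-ones-in-column : ∀ {n} {A : Mat n} → IsASM A → ∀ {i j} → entry A i j ≡ -1ℤ →
  ∃₂ λ c d → c < i × i < d × entry A c j ≡ 1ℤ × entry A d j ≡ 1ℤ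
minus-one-between-ones-in-column asm {i} {j} e
  with minus-one-between-ones (column-line₀ asm j) (trans (lookup∘tabulate _ i) e)
... | c , d , c<i , i<d , Acj≡1 , Adj≡1 =
  c , d , c<i , i<d , trans (sym (lookup∘tabulate _ c)) Acj≡1 , trans (sym (lookup∘tabulate _ d)) Adj≡1

increasing₃ : ∀ {n} {x y z : Fin n} → x < y → y < z → StrictlyIncreasing (lookup (x ∷ y ∷ z ∷ []))
increasing₃ x<y _ zero (suc zero) _ = x<y
increasing₃ x<y y<z zero (suc (suc zero)) _ = <-trans x<y y<z
increasing₃ _ y<z (suc zero) (suc (suc zero)) _ = y<z
increasing₃ _ _ zero zero ()
increasing₃ _ _ (suc zero) zero ()
increasing₃ _ _ (suc zero) (suc zero) (s≤s ())
increasing₃ _ _ (suc (suc zero)) zero ()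
increasing₃ _ _ (suc (suc zero)) (suc zero) (s≤s ())
increasing₃ _ _ (suc (suc zero)) (suc (suc zero)) (s≤s (s≤s ()))

minus-one⇒contains-M : ∀ {n} {A : Mat n} → IsASM A → ∀ {i j} → entry A i j ≡ -1ℤ → Contains A M
minus-one⇒contains-M {A = A} asm {i} {j} e
  with minus-one-between-ones (row-line₀ asm i) e | minus-one-between-ones-in-column asm e
... | a , b , a<j , j<b , Aia≡1 , Aib≡1 | c , d , c<i , i<d , Acj≡1 , Adj≡1 =
  lookup (c ∷ i ∷ d ∷ []) , lookup (a ∷ j ∷ b ∷ []) , increasing₃ c<i i<d , increasing₃ a<j j<b , match
  where
  match : ∀ p q → entry M p q ≡ 1ℤ → entry A (lookup (c ∷ i ∷ d ∷ []) p) (lookup (a ∷ j ∷ b ∷ []) q) ≡ 1ℤ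
  match zero (suc zero) _ = Acj≡1
  match (suc zero) zero _ = Aia≡1
  match (suc zero) (suc (suc zero)) _ = Aib≡1
  match (suc (suc zero)) (suc zero) _ = Adj≡1
  match zero zero ()
  match zero (suc (suc zero)) ()
  match (suc zero) (suc zero) ()
  match (suc (suc zero)) zero ()
  match (suc (suc zero)) (suc (suc zero)) ()

avoids-M⇒isPermMatrix : ∀ {n} {A : Mat n} → IsASM A → Avoids A M → IsPermMatrix A
avoids-M⇒isPermMatrix {n} {A} asm avoids = σ , σ-perm , A≡Pσ
  where
  no-minus-one : ∀ i j → entry A i j ≢ -1ℤ
  no-minus-one i j e = avoids (minus-one⇒contains-M asm e)

  row-unit : ∀ i → ∃[ k ] lookup A i ≡ unitVec k
  row-unit i = line₀-without-minus-one (row-line₀ asm i) (lookup⁻ (no-minus-one i))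

  σ : Vec (Fin n) n
  σ = tabulate (proj₁ ∘ row-unit)

  A≡Pσ : A ≡ permMatrix σ
  A≡Pσ = Pointwise-≡⇒≡ (ext λ i → begin
    lookup A i                    ≡⟨ proj₂ (row-unit i) ⟩
    unitVec (proj₁ (row-unit i))  ≡⟨ cong unitVec (lookup∘tabulate _ i) ⟨
    unitVec (lookup σ i)          ≡⟨ lookup-map i unitVec σ ⟨
    lookup (permMatrix σ) i       ∎)
    where open ≡-Reasoning

  one-at : ∀ i → entry A i (lookup σ i) ≡ 1ℤ
  one-at i = trans (cong (λ X → entry X i (lookup σ i)) A≡Pσ)
                   (trans (entry-permMatrix σ i (lookup σ i)) (δ-diag (lookup σ i)))

  σ-perm : IsPermutation σ
  σ-perm {i} {i′} σi≡σi′ = trans (sym (in-column i refl)) (in-column i′ (sym σi≡σi′))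
    where
    k = lookup σ i
    column-unit : ∃[ r ] column A k ≡ unitVec r
    column-unit = line₀-without-minus-one (column-line₀ asm k) (tabulate⁺ (λ r → no-minus-one r k))
    in-column : ∀ r → lookup σ r ≡ k → proj₁ column-unit ≡ r
    in-column r σr≡k = unitVec-one (subst (λ v → lookup v r ≡ 1ℤ) (proj₂ column-unit)
      (trans (lookup∘tabulate _ r) (subst (λ c → entry A r c ≡ 1ℤ) σr≡k (one-at r))))

isPermMatrix⇒isASM : ∀ {n} {A : Mat n} → IsPermMatrix A → IsASM A
isPermMatrix⇒isASM (_ , σ-perm , refl) = permMatrix-isASM σ-perm

isPermMatrix⇒avoids-M : ∀ {n} {A : Mat n} → IsPermMatrix A → Avoids A M
isPermMatrix⇒avoids-M isPerm = isPermMatrix⇒avoids {B = M} {suc zero} {zero} {suc (suc zero)} isPerm refl refl (s≤s z≤n)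

isPermMatrix⇒avoids-minus-one : ∀ {m n} {A : Mat n} {B : Mat m} {i j} → IsASM B → entry B i j ≡ -1ℤ →
  IsPermMatrix A → Avoids A B
isPermMatrix⇒avoids-minus-one {B = B} {i} asm e isPerm with minus-one-between-ones (row-line₀ asm i) e
... | _ , _ , a<j , j<b , Bia≡1 , Bib≡1 = isPermMatrix⇒avoids {B = B} isPerm Bia≡1 Bib≡1 (<-trans a<j j<b)

proposition6p3 : (∀ (n : ℕ) → HasCard (InASMAvoiding n M) (n !))
    × (∀ (m : ℕ) (A : Mat m) → IsASM A → (∃[ i ] ∃[ j ] (entry A i j ≡ -[1+ 0 ]))
    → ∀ (n : ℕ) → HasAtLeast (InASMAvoiding n A) (n !))
proposition6p3 = avoiding-M , avoiding-minus-one
  where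
  avoiding-M : ∀ n → HasCard (InASMAvoiding n M) (n !)
  avoiding-M n = permMatrices n , (permMatrices-unique n , λ _ → mk⇔ sound complete) , length-permMatrices n
    where
    sound : ∀ {A} → A ∈ permMatrices n → InASMAvoiding n M A
    sound A∈ = isPermMatrix⇒isASM (∈-permMatrices⁻ A∈) , isPermMatrix⇒avoids-M (∈-permMatrices⁻ A∈)
    complete : ∀ {A} → InASMAvoiding n M A → A ∈ permMatrices n
    complete (asm , avoids) = ∈-permMatrices⁺ (avoids-M⇒isPermMatrix asm avoids)

  avoiding-minus-one : ∀ m (B : Mat m) → IsASM B → (∃[ i ] ∃[ j ] (entry B i j ≡ -1ℤ))
    → ∀ n → HasAtLeast (InASMAvoiding n B) (n !)
  avoiding-minus-one m B asm (i , j , e) n =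
    permMatrices n , permMatrices-unique n , member , ≤-reflexive (sym (length-permMatrices n))
    where
    member : ∀ A → A ∈ permMatrices n → InASMAvoiding n B A
    member A A∈ = isPermMatrix⇒isASM (∈-permMatrices⁻ A∈) , isPermMatrix⇒avoids-minus-one asm e (∈-permMatrices⁻ A∈)
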